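{- Fix $M \ge 2$. (i) For every prime $p$ and every $k \ge 1$, $\Gamma_1(p^k)$ is a normal subgroup of $\Gamma_1(p)$. (ii) If $m \mid_s n$, then $\Gamma_1(n)$ is a normal subgroup of $\Gamma_1(m)$.
   Context: For a prime power $p^k$, $k>0$: $\Gamma_1(p^k) := \{ g = (g_{ij}) \in SL_M(\mathbb{Z}) : p^{k-1} \mid g_{ij} \text{ for } i<j,\ p^k \mid (g_{ij} - \delta_{ij}) \text{ for } i \ge j\}$. For $n = p_1^{e_1}\cdots p_s^{e_s}$ (prime factorization), $\Gamma_1(n) := \bigcap_i \Gamma_1(p_i^{e_i})$. We write $m \mid_s n$ ($n$ is a strong multiple of $m$) if $m \mid n$ and every prime occurring in the factorization of $n$ also occurs in the factorization of $m$. -}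

module Defs where

open import Data.Nat as ℕ using (ℕ; zero; suc; _^_)
import Data.Nat.Divisibility as ℕD
open import Data.Nat.Primality using (Prime)
open import Data.Integer as ℤ using (ℤ; +_; _-_; -_)
open import Data.Integer.Divisibility using () renaming (_∣_ to _∣ℤ_)
open import Data.Fin using (Fin; toℕ; punchIn) renaming (zero to fz; suc to fs)
open import Data.Fin.Properties using () renaming (_≟_ to _≟ᶠ_)
open import Data.Product using (_×_)
open import Relation.Nullary using (¬_; yes; no)
open import Relation.Binary.PropositionalEquality using (_≡_)

Mat : ℕ → Set
Mat M = Fin M → Fin M → ℤ

Σ : ∀ {n} → (Fin n → ℤ) → ℤ
Σ {zero}  f = + 0
Σ {suc n} f = f fz ℤ.+ Σ (λ i → f (fs i))

δ : ∀ {M} → Mat M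
δ i j with i ≟ᶠ j
... | yes _ = + 1
... | no  _ = + 0

I : ∀ {M} → Mat M
I = δ

_⊗_ : ∀ {M} → Mat M → Mat M → Mat M
(A ⊗ B) i k = Σ (λ j → A i j ℤ.* B j k)

infixl 7 _⊗_

_≈_ : ∀ {M} → Mat M → Mat M → Set
A ≈ B = ∀ i j → A i j ≡ B i j

sgn : ℕ → ℤ
sgn zero = + 1
sgn (suc k) = - sgn k

det : ∀ {M} → Mat M → ℤ
det {zero}  A = + 1
det {suc M} A = Σ (λ j → sgn (toℕ j) ℤ.* A fz j ℤ.* det (λ r c → A (fs r) (punchIn j c)))

SL : ∀ {M} → Mat M → Set
SL g = det g ≡ + 1

-- Γ₁(p^k), k > 0 (the condition on k is imposed where it is used)
Γ₁pp : ∀ {M} → (p k : ℕ) → Mat M → Set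
Γ₁pp {M} p k g =
  SL g
  × (∀ (i j : Fin M) → toℕ i ℕ.< toℕ j → (+ (p ^ (k ℕ.∸ 1))) ∣ℤ g i j)
  × (∀ (i j : Fin M) → toℕ j ℕ.≤ toℕ i → (+ (p ^ k)) ∣ℤ (g i j - δ i j))

Γ₁ : ∀ {M} → ℕ → Mat M → Set
Γ₁ n g =
  SL g
  × (∀ p e → Prime p → 1 ℕ.≤ e → (p ^ e) ℕD.∣ n → ¬ ((p ^ suc e) ℕD.∣ n) → Γ₁pp p e g)

_∣ₛ_ : ℕ → ℕ → Set
m ∣ₛ n = m ℕD.∣ n × (∀ p → Prime p → p ℕD.∣ n → p ℕD.∣ m)

IsNormalSubgroupOf : ∀ {M} → (Mat M → Set) → (Mat M → Set) → Set
IsNormalSubgroupOf {M} H G =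
  (∀ g → H g → G g)
  × H I
  × (∀ g h → H g → H h → H (g ⊗ h))
  × (∀ g g' → H g → (g ⊗ g') ≈ I → (g' ⊗ g) ≈ I → H g')
  × (∀ g g' h → G g → (g ⊗ g') ≈ I → (g' ⊗ g) ≈ I → H h → H (g ⊗ h ⊗ g'))

{-# OPTIONS --safe #-}
module Submission where

-- Write k = e + 1. An element g of SL lies in Γ₁(p ^ k) exactly when g ⊖ I lies in the lattice
-- Λ p (p ^ e) of matrices divisible by p ^ e above the diagonal and by p ^ k on and below it.
-- A matrix that is upper unitriangular mod p, and its inverse, are upper triangular mod p, and
-- multiplying an element of Λ by such matrices on either side stays in Λ. The identities
-- g h - I = g (h - I) + (g - I),  g⁻¹ - I = - g⁻¹ (g - I)  and  g h g⁻¹ - I = g (h - I) g⁻¹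
-- then make each Γ₁(p ^ k) a group normalised by Γ₁(p). For m ∣ₛ n, Γ₁(n) is the intersection
-- of the Γ₁(p ^ k) over the prime powers exactly dividing n; each such p divides m, so Γ₁(m)
-- normalises all of them, and Γ₁(n) ⊆ Γ₁(m) because the exact prime powers of m divide those
-- of n. Closure of SL needs det (A ⊗ B) = det A * det B, which follows because X ↦ det (X ⊗ B)
-- is an alternating multilinear form in the rows of X, and any such form D satisfies
-- D A = D I * det A.

open import Defs
open import Data.Nat using (ℕ; _≤_; _<_; _^_)
open import Data.Nat.Primality using (Prime; prime⇒nonTrivial; prime⇒nonZero; euclidsLemma)
open import Data.Product using (_×_; _,_; proj₁; Σ-syntax)

open import Data.Empty using (⊥-elim)
open import Data.Fin as Fin using (Fin; toℕ; punchIn; punchOut; inject₁) renaming (zero to fz; suc to fs)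
open import Data.Fin.Induction using (<-wellFounded)
open import Data.Fin.Properties
  using (<⇒≢; punchInᵢ≢i; suc-injective; punchIn-injective; punchIn-punchOut; toℕ-inject₁) renaming (_≟_ to _≟ᶠ_)
open import Data.Integer as ℤ using (ℤ; +_; _+_; _*_; -_; _-_)
open import Data.Integer.Divisibility.Signed
  using (_∣_; divides; ∣m∣n⇒∣m+n; ∣m⇒∣-m; ∣m⇒∣m*n; ∣n⇒∣m*n; ∣-trans; *-monoˡ-∣; *-monoʳ-∣; ∣ᵤ⇒∣; ∣⇒∣ᵤ)
import Data.Integer.Properties as ℤ
open import Data.Integer.Tactic.RingSolver using (solve-∀)
open import Algebra.Properties.Ring ℤ.+-*-ring using (x[y-z]≈xy-xz; [y-z]x≈yx-zx; x+x≈x⇒x≈0; +-inverseʳ-unique)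
open import Algebra.Properties.Semiring.Sum ℤ.+-*-semiring
  using (sum; sum-cong-≗; sum-replicate-zero; ∑-distrib-+; *-distribˡ-sum; sum-remove)
open import Data.Nat as ℕ using (zero; suc; _∸_; z≤n; s≤s)
import Data.Nat.Divisibility as ℕD
import Data.Nat.Properties as ℕ
open import Data.Sum using (inj₁; inj₂)
open import Data.Vec.Functional using (updateAt; removeAt; insertAt; map; tail; _∷_)
open import Data.Vec.Functional.Properties
  using (updateAt-updates; updateAt-minimal; updateAt-id-local; updateAt-commutes; map-updateAt; insertAt-punchIn; insertAt-lookup)
open import Function using (_∘_; const)
open import Induction.WellFounded using (Acc; acc)
open import Relation.Binary.PropositionalEquality
open import Relation.Nullary using (¬_; Dec; yes; no)

Σ≡sum : ∀ {n} (f : Fin n → ℤ) → Σ f ≡ sum f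
Σ≡sum {zero}  f = refl
Σ≡sum {suc n} f = cong (λ s → f fz + s) (Σ≡sum (f ∘ fs))

module _ {n : ℕ} where
  open ≡-Reasoning

  Σ-cong : {f g : Fin n → ℤ} → f ≗ g → Σ f ≡ Σ g
  Σ-cong {f} {g} f≗g = begin
    Σ f   ≡⟨ Σ≡sum f ⟩
    sum f ≡⟨ sum-cong-≗ f≗g ⟩
    sum g ≡⟨ Σ≡sum g ⟨
    Σ g   ∎

  Σ-zero : {f : Fin n → ℤ} → f ≗ const (+ 0) → Σ f ≡ + 0
  Σ-zero {f} f≗0 = trans (Σ-cong f≗0) (trans (Σ≡sum {n} (const (+ 0))) (sum-replicate-zero n))

  Σ-distrib-+ : (f g : Fin n → ℤ) → Σ (λ i → f i + g i) ≡ Σ f + Σ g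
  Σ-distrib-+ f g = begin
    Σ (λ i → f i + g i)   ≡⟨ Σ≡sum (λ i → f i + g i) ⟩
    sum (λ i → f i + g i) ≡⟨ ∑-distrib-+ f g ⟩
    sum f + sum g         ≡⟨ cong₂ _+_ (Σ≡sum f) (Σ≡sum g) ⟨
    Σ f + Σ g             ∎

  Σ-*ˡ : (c : ℤ) (f : Fin n → ℤ) → Σ (λ i → c * f i) ≡ c * Σ f
  Σ-*ˡ c f = begin
    Σ (λ i → c * f i)   ≡⟨ Σ≡sum (λ i → c * f i) ⟩
    sum (λ i → c * f i) ≡⟨ *-distribˡ-sum c f ⟨
    c * sum f           ≡⟨ cong (λ s → c * s) (Σ≡sum f) ⟨
    c * Σ f             ∎

  Σ-linear : (k : ℤ) (f g : Fin n → ℤ) → Σ (λ i → k * f i + g i) ≡ k * Σ f + Σ g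
  Σ-linear k f g = trans (Σ-distrib-+ (λ i → k * f i) g) (cong (_+ Σ g) (Σ-*ˡ k f))

  Σ-neg : (f : Fin n → ℤ) → Σ (λ i → - f i) ≡ - Σ f
  Σ-neg f = begin
    Σ (λ i → - f i)       ≡⟨ Σ-cong (λ i → ℤ.-1*i≡-i (f i)) ⟨
    Σ (λ i → - + 1 * f i) ≡⟨ Σ-*ˡ (- + 1) f ⟩
    - + 1 * Σ f           ≡⟨ ℤ.-1*i≡-i (Σ f) ⟩
    - Σ f                 ∎

  Σ-distrib-- : (f g : Fin n → ℤ) → Σ (λ i → f i - g i) ≡ Σ f - Σ g
  Σ-distrib-- f g = trans (Σ-distrib-+ f (λ i → - g i)) (cong (λ s → Σ f + s) (Σ-neg g))

Σ-single : ∀ {n} (f : Fin n → ℤ) (i : Fin n) → (∀ j → j ≢ i → f j ≡ + 0) → Σ f ≡ f i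
Σ-single {suc n} f i vanish = begin
  Σ f                               ≡⟨ Σ≡sum f ⟩
  sum f                             ≡⟨ sum-remove f ⟩
  f i + sum (λ j → f (punchIn i j)) ≡⟨ cong (λ s → f i + s) rest≡0 ⟩
  f i + + 0                         ≡⟨ ℤ.+-identityʳ (f i) ⟩
  f i                               ∎
  where
  open ≡-Reasoning
  rest≡0 : sum (λ j → f (punchIn i j)) ≡ + 0
  rest≡0 = trans (sym (Σ≡sum (f ∘ punchIn i))) (Σ-zero (λ j → vanish (punchIn i j) (punchInᵢ≢i i j)))

Σ-Σ-cancel : ∀ {k} (H : Fin (suc k) → Fin k → ℤ) →
             (∀ x y → toℕ y ≤ toℕ x → H (fs x) y + H (inject₁ y) x ≡ + 0) →
             Σ (λ j → Σ (H j)) ≡ + 0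
Σ-Σ-cancel {zero}  H _       = refl
Σ-Σ-cancel {suc k} H cancels = begin
  Σ (H fz) + Σ (λ x → H (fs x) fz + Σ (λ c → H (fs x) (fs c)))
    ≡⟨ cong (λ s → Σ (H fz) + s) (Σ-distrib-+ (λ x → H (fs x) fz) (λ x → Σ (λ c → H (fs x) (fs c)))) ⟩
  Σ (H fz) + (Σ (λ x → H (fs x) fz) + Σ (λ x → Σ (λ c → H (fs x) (fs c))))
    ≡⟨ ℤ.+-assoc (Σ (H fz)) _ _ ⟨
  (Σ (H fz) + Σ (λ x → H (fs x) fz)) + Σ (λ x → Σ (λ c → H (fs x) (fs c)))
    ≡⟨ cong₂ _+_ outerPairs innerPairs ⟩
  + 0 ∎
  where
  open ≡-Reasoning
  innerPairs : Σ (λ x → Σ (λ c → H (fs x) (fs c))) ≡ + 0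
  innerPairs = Σ-Σ-cancel (λ x c → H (fs x) (fs c)) (λ x y y≤x → cancels (fs x) (fs y) (s≤s y≤x))
  outerPairs : Σ (H fz) + Σ (λ x → H (fs x) fz) ≡ + 0
  outerPairs = trans (sym (Σ-distrib-+ (H fz) (λ x → H (fs x) fz)))
                     (Σ-zero (λ x → trans (ℤ.+-comm (H fz x) (H (fs x) fz)) (cancels x fz z≤n)))

δ-refl : ∀ {n} (i : Fin n) → δ i i ≡ + 1
δ-refl i with i ≟ᶠ i
... | yes _   = refl
... | no i≢i = ⊥-elim (i≢i refl)

δ-≢ : ∀ {n} {i j : Fin n} → i ≢ j → δ i j ≡ + 0
δ-≢ {i = i} {j} i≢j with i ≟ᶠ j
... | yes i≡j = ⊥-elim (i≢j i≡j)
... | no _    = refl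

δ-punchIn : ∀ {n} (t : Fin (suc n)) (r c : Fin n) → δ (punchIn t r) (punchIn t c) ≡ δ r c
δ-punchIn t r c = by-cases (r ≟ᶠ c)
  where
  by-cases : Dec (r ≡ c) → δ (punchIn t r) (punchIn t c) ≡ δ r c
  by-cases (yes refl) = trans (δ-refl (punchIn t r)) (sym (δ-refl r))
  by-cases (no r≢c)  = trans (δ-≢ (r≢c ∘ punchIn-injective t r c)) (sym (δ-≢ r≢c))

module _ {M : ℕ} where

  infixl 6 _⊕_ _⊖_
  infix 8 ⊝_

  _⊕_ _⊖_ : Mat M → Mat M → Mat M
  (A ⊕ B) i j = A i j + B i j
  (A ⊖ B) i j = A i j - B i j

  ⊝_ : Mat M → Mat M
  (⊝ A) i j = - A i j

  ≈-refl : {A : Mat M} → A ≈ A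
  ≈-refl _ _ = refl

  ≈-sym : {A B : Mat M} → A ≈ B → B ≈ A
  ≈-sym A≈B i j = sym (A≈B i j)

  ≈-trans : {A B C : Mat M} → A ≈ B → B ≈ C → A ≈ C
  ≈-trans A≈B B≈C i j = trans (A≈B i j) (B≈C i j)

  ⊗-cong : {A A′ B B′ : Mat M} → A ≈ A′ → B ≈ B′ → (A ⊗ B) ≈ (A′ ⊗ B′)
  ⊗-cong A≈A′ B≈B′ i k = Σ-cong (λ j → cong₂ _*_ (A≈A′ i j) (B≈B′ j k))

  ⊗-identityˡ : (A : Mat M) → (I ⊗ A) ≈ A
  ⊗-identityˡ A i k = begin
    Σ (λ j → δ i j * A j k) ≡⟨ Σ-single _ i offDiagonal ⟩
    δ i i * A i k           ≡⟨ cong (_* A i k) (δ-refl i) ⟩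
    + 1 * A i k             ≡⟨ ℤ.*-identityˡ (A i k) ⟩
    A i k                   ∎
    where
    open ≡-Reasoning
    offDiagonal : ∀ j → j ≢ i → δ i j * A j k ≡ + 0
    offDiagonal j j≢i = trans (cong (_* A j k) (δ-≢ (j≢i ∘ sym))) (ℤ.*-zeroˡ (A j k))

  ⊗-identityʳ : (A : Mat M) → (A ⊗ I) ≈ A
  ⊗-identityʳ A i k = begin
    Σ (λ j → A i j * δ j k) ≡⟨ Σ-single _ k offDiagonal ⟩
    A i k * δ k k           ≡⟨ cong (A i k *_) (δ-refl k) ⟩
    A i k * + 1             ≡⟨ ℤ.*-identityʳ (A i k) ⟩
    A i k                   ∎
    where
    open ≡-Reasoning
    offDiagonal : ∀ j → j ≢ k → A i j * δ j k ≡ + 0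
    offDiagonal j j≢k = trans (cong (A i j *_) (δ-≢ j≢k)) (ℤ.*-zeroʳ (A i j))

  ⊗-distribˡ-⊖ : (X A B : Mat M) → (X ⊗ (A ⊖ B)) ≈ (X ⊗ A ⊖ X ⊗ B)
  ⊗-distribˡ-⊖ X A B i k =
    trans (Σ-cong (λ j → x[y-z]≈xy-xz (X i j) (A j k) (B j k)))
          (Σ-distrib-- (λ j → X i j * A j k) (λ j → X i j * B j k))

  ⊗-distribʳ-⊖ : (X A B : Mat M) → ((A ⊖ B) ⊗ X) ≈ (A ⊗ X ⊖ B ⊗ X)
  ⊗-distribʳ-⊖ X A B i k =
    trans (Σ-cong (λ j → [y-z]x≈yx-zx (X j k) (A i j) (B i j)))
          (Σ-distrib-- (λ j → A i j * X j k) (λ j → B i j * X j k))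

  ⊖I-⊗ : (g h : Mat M) → ((g ⊗ h) ⊖ I) ≈ (g ⊗ (h ⊖ I) ⊕ (g ⊖ I))
  ⊖I-⊗ g h i j = begin
    (g ⊗ h) i j - δ i j
      ≡⟨ split ((g ⊗ h) i j) (g i j) (δ i j) ⟩
    ((g ⊗ h) i j - g i j) + (g i j - δ i j)
      ≡⟨ cong (λ x → (g ⊗ h) i j - x + (g i j - δ i j)) (⊗-identityʳ g i j) ⟨
    ((g ⊗ h) i j - (g ⊗ I) i j) + (g i j - δ i j)
      ≡⟨ cong (λ x → x + (g i j - δ i j)) (⊗-distribˡ-⊖ g h I i j) ⟨
    (g ⊗ (h ⊖ I)) i j + (g i j - δ i j) ∎
    where
    open ≡-Reasoning
    split : ∀ a b d → a - d ≡ (a - b) + (b - d)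
    split = solve-∀

  ⊖I-inverse : {g g′ : Mat M} → (g′ ⊗ g) ≈ I → (g′ ⊖ I) ≈ (⊝ (g′ ⊗ (g ⊖ I)))
  ⊖I-inverse {g = g} {g′ = g′} g′g≈I i j = begin
    g′ i j - δ i j                        ≡⟨ negate (δ i j) (g′ i j) ⟨
    - (δ i j - g′ i j)                    ≡⟨ cong₂ (λ a b → - (a - b)) (g′g≈I i j) (⊗-identityʳ g′ i j) ⟨
    - ((g′ ⊗ g) i j - (g′ ⊗ I) i j)       ≡⟨ cong -_ (⊗-distribˡ-⊖ g′ g I i j) ⟨
    - (g′ ⊗ (g ⊖ I)) i j                  ∎
    where
    open ≡-Reasoning
    negate : ∀ a b → - (a - b) ≡ b - a
    negate = solve-∀

  ⊖I-conjugate : {g g′ : Mat M} (h : Mat M) → (g ⊗ g′) ≈ I → ((g ⊗ h ⊗ g′) ⊖ I) ≈ (g ⊗ (h ⊖ I) ⊗ g′)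
  ⊖I-conjugate {g} {g′} h gg′≈I i j = begin
    (g ⊗ h ⊗ g′) i j - δ i j
      ≡⟨ cong (λ x → (g ⊗ h ⊗ g′) i j - x) (gg′≈I i j) ⟨
    (g ⊗ h ⊗ g′) i j - (g ⊗ g′) i j
      ≡⟨ cong (λ x → (g ⊗ h ⊗ g′) i j - x) (⊗-cong {A = g ⊗ I} {g} {g′} {g′} (⊗-identityʳ g) ≈-refl i j) ⟨
    (g ⊗ h ⊗ g′) i j - (g ⊗ I ⊗ g′) i j
      ≡⟨ ⊗-distribʳ-⊖ g′ (g ⊗ h) (g ⊗ I) i j ⟨
    ((g ⊗ h ⊖ g ⊗ I) ⊗ g′) i j
      ≡⟨ ⊗-cong {A = g ⊗ h ⊖ g ⊗ I} {g ⊗ (h ⊖ I)} {g′} {g′} (≈-sym (⊗-distribˡ-⊖ g h I)) ≈-refl i j ⟩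
    (g ⊗ (h ⊖ I) ⊗ g′) i j ∎
    where open ≡-Reasoning

rows⇒≈ : ∀ {n} {A B : Mat n} → (∀ r → A r ≡ B r) → A ≈ B
rows⇒≈ A≡B r = cong-app (A≡B r)

module _ {n : ℕ} where

  infixl 9 _[_]≔_

  _[_]≔_ : Mat n → Fin n → (Fin n → ℤ) → Mat n
  A [ i ]≔ u = updateAt A i (const u)

  []≔-≈ : {A B : Mat n} {i : Fin n} {u : Fin n → ℤ} →
          B i ≗ u → (∀ r → r ≢ i → B r ≗ A r) → (A [ i ]≔ u) ≈ B
  []≔-≈ {A} {B} {i} Bi≗u B≗A r c with r ≟ᶠ i
  ... | yes refl = trans (cong-app (updateAt-updates r A) c) (sym (Bi≗u c))
  ... | no r≢i  = trans (cong-app (updateAt-minimal r i A r≢i) c) (sym (B≗A r r≢i c))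

  []≔-cong : {A : Mat n} {i : Fin n} {u v : Fin n → ℤ} → u ≗ v → (A [ i ]≔ u) ≈ (A [ i ]≔ v)
  []≔-cong {A} {i} u≗v = []≔-≈ (λ c → trans (cong-app (updateAt-updates i A) c) (sym (u≗v c)))
                                (λ r r≢i → cong-app (updateAt-minimal r i A r≢i))

  []≔-self : (A : Mat n) (i : Fin n) → (A [ i ]≔ A i) ≈ A
  []≔-self A i = rows⇒≈ (updateAt-id-local i A refl)

  []≔[]≔-≈ : {A B : Mat n} {i j : Fin n} {x y : Fin n → ℤ} →
             B i ≗ x → B j ≗ y → (∀ r → r ≢ i → r ≢ j → B r ≗ A r) →
             ((A [ j ]≔ y) [ i ]≔ x) ≈ B
  []≔[]≔-≈ {A} {B} {i} {j} {x} {y} Bi≗x Bj≗y B≗A r c with r ≟ᶠ i | r ≟ᶠ j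
  ... | yes refl | _        = trans (cong-app (updateAt-updates r (A [ j ]≔ y)) c) (sym (Bi≗x c))
  ... | no r≢i   | yes refl = begin
    ((A [ r ]≔ y) [ i ]≔ x) r c ≡⟨ cong-app (updateAt-minimal r i (A [ r ]≔ y) r≢i) c ⟩
    (A [ r ]≔ y) r c            ≡⟨ cong-app (updateAt-updates r A) c ⟩
    y c                         ≡⟨ Bj≗y c ⟨
    B r c                       ∎
    where open ≡-Reasoning
  ... | no r≢i   | no r≢j   = trans (cong-app (updateAt-minimal r i (A [ j ]≔ _) r≢i) c)
                               (trans (cong-app (updateAt-minimal r j A r≢j) c) (sym (B≗A r r≢i r≢j c)))

  swapRows : Fin n → Fin n → Mat n → Mat n
  swapRows i j A = (A [ j ]≔ A i) [ i ]≔ A j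

punchIn-suc : ∀ {n} {x y : Fin n} → toℕ y ≤ toℕ x → punchIn (fs x) y ≡ inject₁ y
punchIn-suc {y = fz}              _           = refl
punchIn-suc {x = fs x} {y = fs y} (s≤s y≤x) = cong fs (punchIn-suc y≤x)

punchIn-inject₁ : ∀ {n} {x y : Fin n} → toℕ y ≤ toℕ x → punchIn (inject₁ y) x ≡ fs x
punchIn-inject₁ {y = fz}              _           = refl
punchIn-inject₁ {x = fs x} {y = fs y} (s≤s y≤x) = cong fs (punchIn-inject₁ y≤x)

punchIn-exchange : ∀ {n} {x y : Fin (suc n)} → toℕ y ≤ toℕ x →
                   ∀ c → punchIn (fs x) (punchIn y c) ≡ punchIn (inject₁ y) (punchIn x c)
punchIn-exchange {y = fz}                         _           c      = refl
punchIn-exchange {suc n} {x = fs x} {y = fs y} (s≤s y≤x) fz     = refl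
punchIn-exchange {suc n} {x = fs x} {y = fs y} (s≤s y≤x) (fs c) = cong fs (punchIn-exchange y≤x c)

punchIn-inject₁-suc : ∀ {n} {j r : Fin n} → r ≢ j → punchIn (inject₁ j) r ≡ punchIn (fs j) r
punchIn-inject₁-suc {j = fz}   {fz}   r≢j = ⊥-elim (r≢j refl)
punchIn-inject₁-suc {j = fz}   {fs r} _   = refl
punchIn-inject₁-suc {j = fs j} {fz}   _   = refl
punchIn-inject₁-suc {j = fs j} {fs r} r≢j = cong fs (punchIn-inject₁-suc (r≢j ∘ cong fs))

module _ {m : ℕ} (t : Fin (suc m)) where

  insertAt-≗ : {v : Fin m → ℤ} {x : ℤ} {w : Fin (suc m) → ℤ} →
               x ≡ w t → (∀ c → v c ≡ w (punchIn t c)) → insertAt v t x ≗ w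
  insertAt-≗ {v} {x} {w} x≡wₜ v≡w c with t ≟ᶠ c
  ... | yes refl = trans (insertAt-lookup v t x) x≡wₜ
  ... | no t≢c  = begin
    insertAt v t x c                         ≡⟨ cong (insertAt v t x) (punchIn-punchOut t≢c) ⟨
    insertAt v t x (punchIn t (punchOut t≢c)) ≡⟨ insertAt-punchIn v t x (punchOut t≢c) ⟩
    v (punchOut t≢c)                         ≡⟨ v≡w (punchOut t≢c) ⟩
    w (punchIn t (punchOut t≢c))             ≡⟨ cong w (punchIn-punchOut t≢c) ⟩
    w c                                      ∎
    where open ≡-Reasoning

  insertAt-cong : {v w : Fin m → ℤ} {x : ℤ} → v ≗ w → insertAt v t x ≗ insertAt w t x
  insertAt-cong {v} {w} {x} v≗w =
    insertAt-≗ (sym (insertAt-lookup w t x)) (λ c → trans (v≗w c) (sym (insertAt-punchIn w t x c)))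

  insertAt-linear : (k : ℤ) (u v : Fin m → ℤ) →
                    insertAt (λ c → k * u c + v c) t (+ 0) ≗
                    (λ c → k * insertAt u t (+ 0) c + insertAt v t (+ 0) c)
  insertAt-linear k u v = insertAt-≗
    (sym (trans (cong₂ (λ a b → k * a + b) (insertAt-lookup u t (+ 0)) (insertAt-lookup v t (+ 0)))
                (cong (_+ + 0) (ℤ.*-zeroʳ k))))
    (λ c → sym (cong₂ (λ a b → k * a + b) (insertAt-punchIn u t (+ 0) c) (insertAt-punchIn v t (+ 0) c)))

  insertAt-δ : (r : Fin m) → insertAt (δ r) t (+ 0) ≗ δ (punchIn t r)
  insertAt-δ r = insertAt-≗ (sym (δ-≢ (punchInᵢ≢i t r))) (λ c → sym (δ-punchIn t r c))

  insertAt-removeAt-δ : (v : Fin (suc m) → ℤ) → insertAt (removeAt v t) t (+ 0) ≗ (λ c → v c - v t * δ t c)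
  insertAt-removeAt-δ v = insertAt-≗
    (sym (trans (cong (λ d → v t - v t * d) (δ-refl t)) (x-x*1≡0 (v t))))
    (λ c → sym (trans (cong (λ d → v (punchIn t c) - v t * d) (δ-≢ (punchInᵢ≢i t c ∘ sym)))
                      (y-x*0≡y (v (punchIn t c)) (v t))))
    where
    x-x*1≡0 : ∀ x → x - x * + 1 ≡ + 0
    x-x*1≡0 = solve-∀
    y-x*0≡y : ∀ y x → y - x * + 0 ≡ y
    y-x*0≡y = solve-∀

-- Alternating multilinear forms

record IsMultilinear {n} (D : Mat n → ℤ) : Set where
  field
    resp-≈ : ∀ {A B} → A ≈ B → D A ≡ D B
    linear : ∀ A i k (u v : Fin n → ℤ) →
             D (A [ i ]≔ (λ c → k * u c + v c)) ≡ k * D (A [ i ]≔ u) + D (A [ i ]≔ v)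

  zero-row : ∀ A i → D (A [ i ]≔ const (+ 0)) ≡ + 0
  zero-row A i = x+x≈x⇒x≈0 d (begin
    d + d        ≡⟨ cong (_+ d) (ℤ.*-identityˡ d) ⟨
    + 1 * d + d  ≡⟨ linear A i (+ 1) (const (+ 0)) (const (+ 0)) ⟨
    d            ∎)
    where
    open ≡-Reasoning
    d : ℤ
    d = D (A [ i ]≔ const (+ 0))

  additive : ∀ A i (u v : Fin n → ℤ) → D (A [ i ]≔ (λ c → u c + v c)) ≡ D (A [ i ]≔ u) + D (A [ i ]≔ v)
  additive A i u v = begin
    D (A [ i ]≔ (λ c → u c + v c))        ≡⟨ resp-≈ ([]≔-cong (λ c → cong (_+ v c) (ℤ.*-identityˡ (u c)))) ⟨
    D (A [ i ]≔ (λ c → + 1 * u c + v c))  ≡⟨ linear A i (+ 1) u v ⟩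
    + 1 * D (A [ i ]≔ u) + D (A [ i ]≔ v) ≡⟨ cong (_+ D (A [ i ]≔ v)) (ℤ.*-identityˡ (D (A [ i ]≔ u))) ⟩
    D (A [ i ]≔ u) + D (A [ i ]≔ v)       ∎
    where open ≡-Reasoning

  linear-Σ : ∀ {k} A i (f : Fin k → ℤ) (u : Fin k → Fin n → ℤ) →
             D (A [ i ]≔ (λ c → Σ (λ t → f t * u t c))) ≡ Σ (λ t → f t * D (A [ i ]≔ u t))
  linear-Σ {zero}  A i f u = zero-row A i
  linear-Σ {suc k} A i f u =
    trans (linear A i (f fz) (u fz) (λ c → Σ (λ t → f (fs t) * u (fs t) c)))
          (cong (λ s → f fz * D (A [ i ]≔ u fz) + s) (linear-Σ A i (f ∘ fs) (u ∘ fs)))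

  -- D vanishes on the matrix whose rows i and j both equal A i + A j; expanding it by additivity
  -- in both rows gives D A + D (swapRows i j A) plus two terms with equal rows.
  swapRows-antisym : ∀ {i j} → i ≢ j → (∀ B → B i ≗ B j → D B ≡ + 0) →
                     ∀ A → D (swapRows i j A) ≡ - D A
  swapRows-antisym {i} {j} i≢j alternatingᵢⱼ A = +-inverseʳ-unique (D A) (D (swapRows i j A)) (begin
    D A + D (swapRows i j A)                    ≡⟨ cong₂ _+_ (ℤ.+-identityˡ (D A)) (ℤ.+-identityʳ (D (swapRows i j A))) ⟨
    (+ 0 + D A) + (D (swapRows i j A) + + 0)    ≡⟨ cong₂ _+_ (cong₂ _+_ (equalRows (A i)) unchanged)
                                                             (cong (λ d → D (swapRows i j A) + d) (equalRows (A j))) ⟨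
    (D (B (A i) (A i)) + D (B (A i) (A j))) +
      (D (B (A j) (A i)) + D (B (A j) (A j)))   ≡⟨ cong₂ _+_ (additiveⱼ (A i)) (additiveⱼ (A j)) ⟨
    D (B (A i) s) + D (B (A j) s)               ≡⟨ additive (A [ j ]≔ s) i (A i) (A j) ⟨
    D (B s s)                                   ≡⟨ equalRows s ⟩
    + 0                                         ∎)
    where
    open ≡-Reasoning
    B : (x y : Fin n → ℤ) → Mat n
    B x y = (A [ j ]≔ y) [ i ]≔ x
    s : Fin n → ℤ
    s c = A i c + A j c
    rowᵢ : ∀ x y → B x y i ≗ x
    rowᵢ x y = cong-app (updateAt-updates i (A [ j ]≔ y))
    rowⱼ : ∀ x y → B x y j ≗ y
    rowⱼ x y c = trans (cong-app (updateAt-minimal j i (A [ j ]≔ y) (i≢j ∘ sym)) c)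
                       (cong-app (updateAt-updates j A) c)
    equalRows : ∀ x → D (B x x) ≡ + 0
    equalRows x = alternatingᵢⱼ (B x x) (λ c → trans (rowᵢ x x c) (sym (rowⱼ x x c)))
    unchanged : D (B (A i) (A j)) ≡ D A
    unchanged = resp-≈ ([]≔[]≔-≈ (λ _ → refl) (λ _ → refl) (λ _ _ _ _ → refl))
    commute : ∀ x y → B x y ≈ ((A [ i ]≔ x) [ j ]≔ y)
    commute x y = rows⇒≈ (updateAt-commutes i j i≢j A)
    additiveⱼ : ∀ x → D (B x s) ≡ D (B x (A i)) + D (B x (A j))
    additiveⱼ x = begin
      D (B x s)
        ≡⟨ resp-≈ (commute x s) ⟩
      D ((A [ i ]≔ x) [ j ]≔ s)
        ≡⟨ additive (A [ i ]≔ x) j (A i) (A j) ⟩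
      D ((A [ i ]≔ x) [ j ]≔ A i) + D ((A [ i ]≔ x) [ j ]≔ A j)
        ≡⟨ cong₂ _+_ (resp-≈ (commute x (A i))) (resp-≈ (commute x (A j))) ⟨
      D (B x (A i)) + D (B x (A j)) ∎

Alternates : ∀ {n} → (Mat n → ℤ) → Set
Alternates {n} D = ∀ A {i j : Fin n} → i ≢ j → A i ≗ A j → D A ≡ + 0

record IsAlternating {n} (D : Mat n → ℤ) : Set where
  field
    isMultilinear : IsMultilinear D
    alternating   : Alternates D

  open IsMultilinear isMultilinear public

  swapRows-negates : ∀ {i j} → i ≢ j → ∀ A → D (swapRows i j A) ≡ - D A
  swapRows-negates i≢j = swapRows-antisym i≢j (λ B → alternating B i≢j)

  addRowMultiple : ∀ A {i j} → i ≢ j → ∀ k → D (A [ i ]≔ (λ c → k * A j c + A i c)) ≡ D A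
  addRowMultiple A {i} {j} i≢j k = begin
    D (A [ i ]≔ (λ c → k * A j c + A i c))      ≡⟨ linear A i k (A j) (A i) ⟩
    k * D (A [ i ]≔ A j) + D (A [ i ]≔ A i)     ≡⟨ cong₂ (λ a b → k * a + b) (alternating (A [ i ]≔ A j) i≢j equalRows)
                                                                              (resp-≈ ([]≔-self A i)) ⟩
    k * + 0 + D A                               ≡⟨ cong (_+ D A) (ℤ.*-zeroʳ k) ⟩
    + 0 + D A                                   ≡⟨ ℤ.+-identityˡ (D A) ⟩
    D A                                         ∎
    where
    open ≡-Reasoning
    equalRows : (A [ i ]≔ A j) i ≗ (A [ i ]≔ A j) j
    equalRows c = trans (cong-app (updateAt-updates i A) c) (sym (cong-app (updateAt-minimal j i A (i≢j ∘ sym)) c))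

-- The determinant

minor : ∀ {n} → Fin (suc n) → Mat (suc n) → Mat n
minor j A = map (λ row → removeAt row j) (tail A)

det-resp-≈ : ∀ {n} {A B : Mat n} → A ≈ B → det A ≡ det B
det-resp-≈ {zero}  _   = refl
det-resp-≈ {suc n} A≈B = Σ-cong (λ j → cong₂ (λ a d → sgn (toℕ j) * a * d) (A≈B fz j)
                                              (det-resp-≈ (λ r c → A≈B (fs r) (punchIn j c))))

det-minor-[]≔ : ∀ {n} (A : Mat (suc (suc n))) j i u →
                det (minor j (A [ fs i ]≔ u)) ≡ det (minor j A [ i ]≔ removeAt u j)
det-minor-[]≔ A j i u = det-resp-≈ (rows⇒≈
  (map-updateAt {f = λ row → removeAt row j} {g = const u} {h = const (removeAt u j)} (λ _ → refl) (tail A) i))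

det-linear : ∀ {n} (A : Mat n) i k (u v : Fin n → ℤ) →
             det (A [ i ]≔ (λ c → k * u c + v c)) ≡ k * det (A [ i ]≔ u) + det (A [ i ]≔ v)
det-linear {suc n} A fz k u v =
  trans (Σ-cong (λ j → distribute (sgn (toℕ j)) k (u j) (v j) (det (minor j A))))
        (Σ-linear k (λ j → sgn (toℕ j) * u j * det (minor j A)) (λ j → sgn (toℕ j) * v j * det (minor j A)))
  where
  distribute : ∀ s k a b d → s * (k * a + b) * d ≡ k * (s * a * d) + s * b * d
  distribute = solve-∀
det-linear {suc (suc n)} A (fs i) k u v =
  trans (Σ-cong expand)
        (Σ-linear k (λ j → cof j * det (minor j (A [ fs i ]≔ u))) (λ j → cof j * det (minor j (A [ fs i ]≔ v))))
  where
  open ≡-Reasoning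
  cof : Fin (suc (suc n)) → ℤ
  cof j = sgn (toℕ j) * A fz j
  expand : ∀ j → cof j * det (minor j (A [ fs i ]≔ (λ c → k * u c + v c))) ≡
                 k * (cof j * det (minor j (A [ fs i ]≔ u))) + cof j * det (minor j (A [ fs i ]≔ v))
  expand j = begin
    cof j * det (minor j (A [ fs i ]≔ (λ c → k * u c + v c)))
      ≡⟨ cong (cof j *_) (trans (det-minor-[]≔ A j i _) (det-linear (minor j A) i k (removeAt u j) (removeAt v j))) ⟩
    cof j * (k * det (minor j A [ i ]≔ removeAt u j) + det (minor j A [ i ]≔ removeAt v j))
      ≡⟨ cong₂ (λ a b → cof j * (k * a + b)) (det-minor-[]≔ A j i u) (det-minor-[]≔ A j i v) ⟨
    cof j * (k * det (minor j (A [ fs i ]≔ u)) + det (minor j (A [ fs i ]≔ v)))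
      ≡⟨ distribute (cof j) k _ _ ⟩
    k * (cof j * det (minor j (A [ fs i ]≔ u))) + cof j * det (minor j (A [ fs i ]≔ v)) ∎
    where
    distribute : ∀ c k a b → c * (k * a + b) ≡ k * (c * a) + c * b
    distribute = solve-∀

det-isMultilinear : ∀ {n} → IsMultilinear (det {n})
det-isMultilinear = record { resp-≈ = det-resp-≈ ; linear = det-linear }

det-alternates-below : ∀ {n} → Alternates (det {n}) →
                       ∀ (A : Mat (suc n)) {a b} → a ≢ b → A (fs a) ≗ A (fs b) → det A ≡ + 0
det-alternates-below alternatesₙ A a≢b rows-equal =
  Σ-zero (λ j → trans (cong (sgn (toℕ j) * A fz j *_) (alternatesₙ (minor j A) a≢b (rows-equal ∘ punchIn j)))
                      (ℤ.*-zeroʳ (sgn (toℕ j) * A fz j)))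

-- Expanding along rows 0 and 1, the term for columns (j, punchIn j c) cancels the one for
-- (punchIn j c, j); these pairs are (fs x, y) and (inject₁ y, x) with y ≤ x.
det-alternates-01 : ∀ {m} (A : Mat (suc (suc m))) → A fz ≗ A (fs fz) → det A ≡ + 0
det-alternates-01 A row₀≗row₁ = trans (Σ-cong (λ j → sym (Σ-*ˡ (cof j) (term j)))) (Σ-Σ-cancel H pair-cancels)
  where
  cof : Fin _ → ℤ
  cof j = sgn (toℕ j) * A fz j
  term : Fin _ → Fin _ → ℤ
  term j c = sgn (toℕ c) * A (fs fz) (punchIn j c) * det (minor c (minor j A))
  H : Fin _ → Fin _ → ℤ
  H j c = cof j * term j c
  pair-cancels : ∀ x y → toℕ y ≤ toℕ x → H (fs x) y + H (inject₁ y) x ≡ + 0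
  pair-cancels x y y≤x = begin
    H (fs x) y + H (inject₁ y) x
      ≡⟨ cong₂ _+_ first second ⟩
    (- sgn (toℕ x)) * A fz (fs x) * (sgn (toℕ y) * A fz (inject₁ y) * d) +
      sgn (toℕ y) * A fz (inject₁ y) * (sgn (toℕ x) * A fz (fs x) * d)
      ≡⟨ opposite (sgn (toℕ x)) (sgn (toℕ y)) (A fz (fs x)) (A fz (inject₁ y)) d ⟩
    + 0 ∎
    where
    open ≡-Reasoning
    d : ℤ
    d = det (minor y (minor (fs x) A))
    first : H (fs x) y ≡ (- sgn (toℕ x)) * A fz (fs x) * (sgn (toℕ y) * A fz (inject₁ y) * d)
    first = cong (λ a → (- sgn (toℕ x)) * A fz (fs x) * (sgn (toℕ y) * a * d))
                 (trans (cong (A (fs fz)) (punchIn-suc y≤x)) (sym (row₀≗row₁ (inject₁ y))))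
    second : H (inject₁ y) x ≡ sgn (toℕ y) * A fz (inject₁ y) * (sgn (toℕ x) * A fz (fs x) * d)
    second = cong₂ (λ s e → sgn s * A fz (inject₁ y) * e) (toℕ-inject₁ y)
               (cong₂ (λ a e → sgn (toℕ x) * a * e)
                      (trans (cong (A (fs fz)) (punchIn-inject₁ y≤x)) (sym (row₀≗row₁ (fs x))))
                      (det-resp-≈ (λ r c → cong (A (fs (fs r))) (sym (punchIn-exchange y≤x c)))))
    opposite : ∀ s t p q e → (- s) * p * (t * q * e) + t * q * (s * p * e) ≡ + 0
    opposite = solve-∀

det-alternates-0 : ∀ {n} → Alternates (det {n}) →
                   ∀ (A : Mat (suc n)) b → A fz ≗ A (fs b) → det A ≡ + 0
det-alternates-0                 _          A fz     row₀≗row₁ = det-alternates-01 A row₀≗row₁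
det-alternates-0 {suc (suc n)} alternatesₙ A (fs b) row₀≗row = begin
  det A                                  ≡⟨ ℤ.neg-involutive (det A) ⟨
  - - det A                              ≡⟨ cong -_ (swapRows-antisym (λ ()) alternates₁ A) ⟨
  - det (swapRows (fs fz) (fs (fs b)) A) ≡⟨ cong -_ (det-alternates-01 (swapRows (fs fz) (fs (fs b)) A) row₀≗row) ⟩
  + 0                                    ∎
  where
  open ≡-Reasoning
  open IsMultilinear det-isMultilinear
  alternates₁ : ∀ B → B (fs fz) ≗ B (fs (fs b)) → det B ≡ + 0
  alternates₁ B = det-alternates-below alternatesₙ B {fz} {fs b} (λ ())

det-alternates : ∀ {n} → Alternates (det {n})
det-alternates {suc n} A {fz}   {fz}   0≢0 _ = ⊥-elim (0≢0 refl)
det-alternates {suc n} A {fs a} {fs b} a≢b rows = det-alternates-below det-alternates A (a≢b ∘ cong fs) rows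
det-alternates {suc n} A {fz}   {fs b} _   rows = det-alternates-0 det-alternates A b rows
det-alternates {suc n} A {fs a} {fz}   _   rows = det-alternates-0 det-alternates A a (sym ∘ rows)

det-isAlternating : ∀ {n} → IsAlternating (det {n})
det-isAlternating = record { isMultilinear = det-isMultilinear ; alternating = det-alternates }

-- Uniqueness of alternating forms; multiplicativity of det

zeroing-invariant⇒constant : ∀ {m} (F : (Fin m → ℤ) → ℤ) → (∀ {k k′} → k ≗ k′ → F k ≡ F k′) →
                             (∀ k r → F k ≡ F (updateAt k r (const (+ 0)))) →
                             ∀ k → F k ≡ F (const (+ 0))
zeroing-invariant⇒constant {zero}  F resp _         k = resp (λ ())
zeroing-invariant⇒constant {suc m} F resp invariant k = begin
  F k                             ≡⟨ invariant k fz ⟩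
  F (updateAt k fz (const (+ 0))) ≡⟨ resp (λ { fz → refl ; (fs r) → refl }) ⟩
  G (tail k)                      ≡⟨ zeroing-invariant⇒constant G G-resp G-invariant (tail k) ⟩
  G (const (+ 0))                 ≡⟨ resp (λ { fz → refl ; (fs r) → refl }) ⟩
  F (const (+ 0))                 ∎
  where
  open ≡-Reasoning
  G : (Fin m → ℤ) → ℤ
  G k′ = F (+ 0 ∷ k′)
  G-resp : ∀ {k k′} → k ≗ k′ → G k ≡ G k′
  G-resp k≗k′ = resp (λ { fz → refl ; (fs r) → k≗k′ r })
  G-invariant : ∀ k′ r → G k′ ≡ G (updateAt k′ r (const (+ 0)))
  G-invariant k′ r = trans (invariant (+ 0 ∷ k′) (fs r)) (resp (λ { fz → refl ; (fs r′) → refl }))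

module _ {m : ℕ} where

  border : Fin (suc m) → Mat m → Mat (suc m)
  border t N = δ t ∷ map (λ row → insertAt row t (+ 0)) N

  addFirstRow : (Fin m → ℤ) → Mat (suc m) → Mat (suc m)
  addFirstRow k B = B fz ∷ (λ r c → k r * B fz c + B (fs r) c)

  cycleMatrix : Fin (suc m) → Mat (suc m)
  cycleMatrix t = I ∘ (t ∷ punchIn t)

  unitRow≈addFirstRow-border : (A : Mat (suc m)) (t : Fin (suc m)) →
    (A [ fz ]≔ δ t) ≈ addFirstRow (λ r → A (fs r) t) (border t (minor t A))
  unitRow≈addFirstRow-border A t fz     c = refl
  unitRow≈addFirstRow-border A t (fs r) c = begin
    A (fs r) c
      ≡⟨ split (A (fs r) c) (A (fs r) t * δ t c) ⟩
    A (fs r) t * δ t c + (A (fs r) c - A (fs r) t * δ t c)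
      ≡⟨ cong (λ e → A (fs r) t * δ t c + e) (insertAt-removeAt-δ t (A (fs r)) c) ⟨
    A (fs r) t * δ t c + insertAt (removeAt (A (fs r)) t) t (+ 0) c ∎
    where
    open ≡-Reasoning
    split : ∀ a b → a ≡ b + (a - b)
    split = solve-∀

  border-I : (t : Fin (suc m)) → border t I ≈ cycleMatrix t
  border-I t fz     = λ _ → refl
  border-I t (fs r) = insertAt-δ t r

  border-[]≔ : (t : Fin (suc m)) (N : Mat m) (i : Fin m) (u : Fin m → ℤ) →
               border t (N [ i ]≔ u) ≈ (border t N [ fs i ]≔ insertAt u t (+ 0))
  border-[]≔ t N i u = rows⇒≈ λ
    { fz     → refl
    ; (fs r) → map-updateAt {f = λ row → insertAt row t (+ 0)} {g = const u} {h = const (insertAt u t (+ 0))}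
                            (λ _ → refl) N i r
    }

module _ {m : ℕ} {D : Mat (suc m) → ℤ} (D-alternating : IsAlternating D) where
  open IsAlternating D-alternating

  -- Each multiplier k r can be reset to 0 by subtracting k r times row 0 from row fs r.
  addFirstRow-invariant : ∀ k B → D (addFirstRow k B) ≡ D B
  addFirstRow-invariant k B = begin
    D (addFirstRow k B)              ≡⟨ zeroing-invariant⇒constant F F-resp zeroing k ⟩
    D (addFirstRow (const (+ 0)) B)  ≡⟨ resp-≈ (λ { fz c → refl ; (fs r) c → 0*x+y≡y (B fz c) (B (fs r) c) }) ⟩
    D B                              ∎
    where
    open ≡-Reasoning
    0*x+y≡y : ∀ x y → + 0 * x + y ≡ y
    0*x+y≡y = solve-∀
    F : (Fin m → ℤ) → ℤ
    F k = D (addFirstRow k B)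
    F-resp : ∀ {k k′} → k ≗ k′ → F k ≡ F k′
    F-resp k≗k′ = resp-≈ (λ { fz c → refl ; (fs r) c → cong (λ a → a * B fz c + B (fs r) c) (k≗k′ r) })
    zeroing : ∀ k r → F k ≡ F (updateAt k r (const (+ 0)))
    zeroing k r = trans (resp-≈ (≈-sym ([]≔-≈ {A = X} rowᵣ others))) (addRowMultiple X {fs r} {fz} (λ ()) (k r))
      where
      X : Mat (suc m)
      X = addFirstRow (updateAt k r (const (+ 0))) B
      rowᵣ : addFirstRow k B (fs r) ≗ (λ c → k r * X fz c + X (fs r) c)
      rowᵣ c = sym (trans (cong (λ a → k r * B fz c + (a * B fz c + B (fs r) c)) (updateAt-updates r k))
                          (cong (λ e → k r * B fz c + e) (0*x+y≡y (B fz c) (B (fs r) c))))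
      others : ∀ r′ → r′ ≢ fs r → addFirstRow k B r′ ≗ X r′
      others fz      _      c = refl
      others (fs r′) r′≢r c =
        cong (λ a → a * B fz c + B (fs r′) c) (sym (updateAt-minimal r′ r k (r′≢r ∘ cong fs)))

  border-isAlternating : ∀ t → IsAlternating (D ∘ border t)
  border-isAlternating t = record
    { isMultilinear = record
      { resp-≈ = λ {N} {N′} N≈N′ → resp-≈ (border-resp {N} {N′} N≈N′)
      ; linear = border-linear
      }
    ; alternating   = border-alternates
    }
    where
    border-resp : ∀ {N N′} → N ≈ N′ → border t N ≈ border t N′
    border-resp N≈N′ fz     = λ _ → refl
    border-resp N≈N′ (fs r) = insertAt-cong t (N≈N′ r)
    border-alternates : Alternates (D ∘ border t)
    border-alternates N {a} {b} a≢b rows-equal =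
      alternating (border t N) {fs a} {fs b} (a≢b ∘ suc-injective) (insertAt-cong t rows-equal)
    border-linear : ∀ N i k (u v : Fin m → ℤ) →
      D (border t (N [ i ]≔ (λ c → k * u c + v c))) ≡ k * D (border t (N [ i ]≔ u)) + D (border t (N [ i ]≔ v))
    border-linear N i k u v = begin
      D (border t (N [ i ]≔ (λ c → k * u c + v c)))
        ≡⟨ resp-≈ (≈-trans (border-[]≔ t N i (λ c → k * u c + v c))
                           ([]≔-cong {A = border t N} {i = fs i} (insertAt-linear t k u v))) ⟩
      D (border t N [ fs i ]≔ (λ c → k * insertAt u t (+ 0) c + insertAt v t (+ 0) c))
        ≡⟨ linear (border t N) (fs i) k _ _ ⟩
      k * D (border t N [ fs i ]≔ insertAt u t (+ 0)) + D (border t N [ fs i ]≔ insertAt v t (+ 0))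
        ≡⟨ cong₂ (λ a b → k * a + b) (resp-≈ (border-[]≔ t N i u)) (resp-≈ (border-[]≔ t N i v)) ⟨
      k * D (border t (N [ i ]≔ u)) + D (border t (N [ i ]≔ v)) ∎
      where open ≡-Reasoning

  cycleMatrix-sign : ∀ t → D (cycleMatrix t) ≡ sgn (toℕ t) * D I
  cycleMatrix-sign t = by-rank (toℕ t) t refl
    where
    by-rank : ∀ k t → toℕ t ≡ k → D (cycleMatrix t) ≡ sgn k * D I
    by-rank zero    fz     refl = trans (resp-≈ (λ { fz c → refl ; (fs r) c → refl })) (sym (ℤ.*-identityˡ (D I)))
    by-rank (suc k) (fs j) refl = begin
      D (cycleMatrix (fs j))                               ≡⟨ ℤ.neg-involutive _ ⟨
      - - D (cycleMatrix (fs j))                           ≡⟨ cong -_ (swapRows-negates {fz} {fs j} (λ ()) (cycleMatrix (fs j))) ⟨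
      - D (swapRows fz (fs j) (cycleMatrix (fs j)))        ≡⟨ cong -_ (resp-≈ swapped) ⟩
      - D (cycleMatrix (inject₁ j))                        ≡⟨ cong -_ (by-rank (toℕ j) (inject₁ j) (toℕ-inject₁ j)) ⟩
      - (sgn (toℕ j) * D I)                                ≡⟨ ℤ.neg-distribˡ-* (sgn (toℕ j)) (D I) ⟩
      sgn (suc (toℕ j)) * D I                              ∎
      where
      open ≡-Reasoning
      swapped : swapRows fz (fs j) (cycleMatrix (fs j)) ≈ cycleMatrix (inject₁ j)
      swapped = []≔[]≔-≈ {i = fz} {j = fs j}
                  (λ c → cong (λ x → δ x c) (sym (punchIn-suc ℕ.≤-refl)))
                  (λ c → cong (λ x → δ x c) (punchIn-inject₁ ℕ.≤-refl))
                  (λ { fz 0≢0 _ → ⊥-elim (0≢0 refl)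
                     ; (fs r) _ r≢j c → cong (λ x → δ x c) (punchIn-inject₁-suc (r≢j ∘ cong fs)) })

-- Expand the first row of A: after clearing column t, D (A [ fz ]≔ δ t) becomes the value at
-- minor t A of D ∘ border t, an alternating form one size smaller.
alternating-unique : ∀ {n} {D : Mat n → ℤ} → IsAlternating D → ∀ A → D A ≡ D I * det A
alternating-unique {zero} {D} D-alternating A = trans (resp-≈ (λ ())) (sym (ℤ.*-identityʳ (D I)))
  where open IsAlternating D-alternating
alternating-unique {suc m} {D} D-alternating A = begin
  D A
    ≡⟨ resp-≈ (≈-sym firstRow-expanded) ⟩
  D (A [ fz ]≔ (λ c → Σ (λ t → A fz t * δ t c)))
    ≡⟨ linear-Σ A fz (A fz) δ ⟩
  Σ (λ t → A fz t * D (A [ fz ]≔ δ t))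
    ≡⟨ Σ-cong (λ t → cong (A fz t *_) (unitRow t)) ⟩
  Σ (λ t → A fz t * (sgn (toℕ t) * D I * det (minor t A)))
    ≡⟨ Σ-cong (λ t → rearrange (A fz t) (sgn (toℕ t)) (D I) (det (minor t A))) ⟩
  Σ (λ t → D I * (sgn (toℕ t) * A fz t * det (minor t A)))
    ≡⟨ Σ-*ˡ (D I) (λ t → sgn (toℕ t) * A fz t * det (minor t A)) ⟩
  D I * det A ∎
  where
  open ≡-Reasoning
  open IsAlternating D-alternating
  firstRow-expanded : (A [ fz ]≔ (A ⊗ I) fz) ≈ A
  firstRow-expanded = []≔-≈ (λ c → sym (⊗-identityʳ A fz c)) (λ _ _ _ → refl)
  unitRow : ∀ t → D (A [ fz ]≔ δ t) ≡ sgn (toℕ t) * D I * det (minor t A)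
  unitRow t = begin
    D (A [ fz ]≔ δ t)
      ≡⟨ resp-≈ (unitRow≈addFirstRow-border A t) ⟩
    D (addFirstRow (λ r → A (fs r) t) (border t (minor t A)))
      ≡⟨ addFirstRow-invariant D-alternating (λ r → A (fs r) t) (border t (minor t A)) ⟩
    D (border t (minor t A))
      ≡⟨ alternating-unique (border-isAlternating D-alternating t) (minor t A) ⟩
    D (border t I) * det (minor t A)
      ≡⟨ cong (_* det (minor t A)) (trans (resp-≈ (border-I t)) (cycleMatrix-sign D-alternating t)) ⟩
    sgn (toℕ t) * D I * det (minor t A) ∎
  rearrange : ∀ a s d e → a * (s * d * e) ≡ d * (s * a * e)
  rearrange = solve-∀

det-I : ∀ {n} → det (I {n}) ≡ + 1
det-I {zero}  = refl
det-I {suc n} = begin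
  Σ (λ j → sgn (toℕ j) * δ fz j * det (minor j I′)) ≡⟨ Σ-single _ fz offDiagonal ⟩
  + 1 * + 1 * det (minor fz I′)                     ≡⟨ ℤ.*-identityˡ (det (minor fz I′)) ⟩
  det (minor fz I′)                                 ≡⟨ det-resp-≈ {A = minor fz I′} {B = I} (δ-punchIn fz) ⟩
  det (I {n})                                       ≡⟨ det-I {n} ⟩
  + 1                                               ∎
  where
  open ≡-Reasoning
  I′ : Mat (suc n)
  I′ = I
  offDiagonal : ∀ j → j ≢ fz → sgn (toℕ j) * δ fz j * det (minor j I′) ≡ + 0
  offDiagonal j j≢0 = begin
    sgn (toℕ j) * δ fz j * det (minor j I′) ≡⟨ cong (λ d → sgn (toℕ j) * d * det (minor j I′)) (δ-≢ (j≢0 ∘ sym)) ⟩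
    sgn (toℕ j) * + 0 * det (minor j I′)    ≡⟨ cong (_* det (minor j I′)) (ℤ.*-zeroʳ (sgn (toℕ j))) ⟩
    + 0 * det (minor j I′)                  ≡⟨ ℤ.*-zeroˡ (det (minor j I′)) ⟩
    + 0                                     ∎

det-⊗ : ∀ {n} (A B : Mat n) → det (A ⊗ B) ≡ det A * det B
det-⊗ {n} A B = begin
  det (A ⊗ B)         ≡⟨ alternating-unique ⊗B-isAlternating A ⟩
  det (I ⊗ B) * det A ≡⟨ cong (_* det A) (det-resp-≈ (⊗-identityˡ B)) ⟩
  det B * det A       ≡⟨ ℤ.*-comm (det B) (det A) ⟩
  det A * det B       ∎
  where
  open ≡-Reasoning
  open IsAlternating det-isAlternating using (resp-≈; linear; alternating)
  _⊗ᵣB : (Fin n → ℤ) → Fin n → ℤ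
  (u ⊗ᵣB) k = Σ (λ j → u j * B j k)
  []≔-⊗ : ∀ X i u → ((X [ i ]≔ u) ⊗ B) ≈ ((X ⊗ B) [ i ]≔ (u ⊗ᵣB))
  []≔-⊗ X i u = rows⇒≈ (map-updateAt {f = _⊗ᵣB} {g = const u} {h = const (u ⊗ᵣB)} (λ _ → refl) X i)
  ⊗ᵣB-linear : ∀ k u v → ((λ c → k * u c + v c) ⊗ᵣB) ≗ (λ c → k * (u ⊗ᵣB) c + (v ⊗ᵣB) c)
  ⊗ᵣB-linear k u v c = trans (Σ-cong (λ j → distribute k (u j) (v j) (B j c)))
                             (Σ-linear k (λ j → u j * B j c) (λ j → v j * B j c))
    where
    distribute : ∀ k a b x → (k * a + b) * x ≡ k * (a * x) + b * x
    distribute = solve-∀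
  ⊗B-linear : ∀ X i k u v →
    det ((X [ i ]≔ (λ c → k * u c + v c)) ⊗ B) ≡ k * det ((X [ i ]≔ u) ⊗ B) + det ((X [ i ]≔ v) ⊗ B)
  ⊗B-linear X i k u v = begin
    det ((X [ i ]≔ (λ c → k * u c + v c)) ⊗ B)
      ≡⟨ resp-≈ (≈-trans ([]≔-⊗ X i _) ([]≔-cong {A = X ⊗ B} {i = i} (⊗ᵣB-linear k u v))) ⟩
    det ((X ⊗ B) [ i ]≔ (λ c → k * (u ⊗ᵣB) c + (v ⊗ᵣB) c))
      ≡⟨ linear (X ⊗ B) i k (u ⊗ᵣB) (v ⊗ᵣB) ⟩
    k * det ((X ⊗ B) [ i ]≔ (u ⊗ᵣB)) + det ((X ⊗ B) [ i ]≔ (v ⊗ᵣB))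
      ≡⟨ cong₂ (λ a b → k * a + b) (resp-≈ ([]≔-⊗ X i u)) (resp-≈ ([]≔-⊗ X i v)) ⟨
    k * det ((X [ i ]≔ u) ⊗ B) + det ((X [ i ]≔ v) ⊗ B) ∎
  ⊗B-isAlternating : IsAlternating (λ X → det (X ⊗ B))
  ⊗B-isAlternating = record
    { isMultilinear = record
      { resp-≈ = λ {X} {X′} X≈X′ → resp-≈ (⊗-cong {A = X} {X′} {B} {B} X≈X′ ≈-refl)
      ; linear = ⊗B-linear
      }
    ; alternating = λ X {i} {j} i≢j rowᵢ≗rowⱼ →
        alternating (X ⊗ B) {i} {j} i≢j (λ k → Σ-cong (λ l → cong (_* B l k) (rowᵢ≗rowⱼ l)))
    }

module _ {M : ℕ} where

  SL-⊗ : {g h : Mat M} → SL g → SL h → SL (g ⊗ h)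
  SL-⊗ {g} {h} g∈SL h∈SL = trans (det-⊗ g h) (cong₂ _*_ g∈SL h∈SL)

  SL-inverse : {g g′ : Mat M} → SL g → (g ⊗ g′) ≈ I → SL g′
  SL-inverse {g} {g′} g∈SL gg′≈I = begin
    det g′           ≡⟨ ℤ.*-identityˡ (det g′) ⟨
    + 1 * det g′     ≡⟨ cong (_* det g′) g∈SL ⟨
    det g * det g′   ≡⟨ det-⊗ g g′ ⟨
    det (g ⊗ g′)     ≡⟨ det-resp-≈ gg′≈I ⟩
    det (I {M})      ≡⟨ det-I {M} ⟩
    + 1              ∎
    where open ≡-Reasoning

-- Congruence lattices

∣-Σ : ∀ {n} {d : ℤ} (f : Fin n → ℤ) → (∀ i → d ∣ f i) → d ∣ Σ f
∣-Σ {zero}  f _   = divides (+ 0) refl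
∣-Σ {suc n} f d∣f = ∣m∣n⇒∣m+n (d∣f fz) (∣-Σ (f ∘ fs) (d∣f ∘ fs))

*-mono-∣ : ∀ {a b x y : ℤ} → a ∣ x → b ∣ y → a * b ∣ x * y
*-mono-∣ {a} {b} {x} {y} a∣x b∣y = ∣-trans (*-monoˡ-∣ b a∣x) (*-monoʳ-∣ x b∣y)

record Λ {M} (p q : ℤ) (X : Mat M) : Set where
  field
    above     : ∀ i j → toℕ i < toℕ j → q ∣ X i j
    onOrBelow : ∀ i j → toℕ j ≤ toℕ i → p * q ∣ X i j

open Λ

module _ {M : ℕ} where

  UpperTriangularMod : ℤ → Mat M → Set
  UpperTriangularMod p U = ∀ i j → toℕ j < toℕ i → p ∣ U i j

  UnitriangularMod : ℤ → Mat M → Set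
  UnitriangularMod p g = ∀ i j → toℕ j ≤ toℕ i → p ∣ (g ⊖ I) i j

  ⊖I-offDiagonal : (g : Mat M) {i j : Fin M} → i ≢ j → (g ⊖ I) i j ≡ g i j
  ⊖I-offDiagonal g {i} {j} i≢j = trans (cong (λ d → g i j - d) (δ-≢ i≢j)) (ℤ.+-identityʳ (g i j))

  unitriangular⇒triangular : ∀ {p g} → UnitriangularMod p g → UpperTriangularMod p g
  unitriangular⇒triangular {p = p} {g = g} g-unitri i j j<i =
    subst (p ∣_) (⊖I-offDiagonal g (<⇒≢ j<i ∘ sym)) (g-unitri i j (ℕ.<⇒≤ j<i))

  -- The entries of g′ below the diagonal are determined column by column from the left,
  -- since g′ = I - g′ ⊗ (g ⊖ I) and g ⊖ I vanishes mod p on and below the diagonal.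
  inverse-triangular : ∀ {p} {g g′ : Mat M} → UnitriangularMod p g → (g′ ⊗ g) ≈ I → UpperTriangularMod p g′
  inverse-triangular {p = p} {g = g} {g′ = g′} g-unitri g′g≈I i j j<i =
    by-column j (<-wellFounded j) j<i
    where
    by-column : ∀ j → Acc Fin._<_ j → toℕ j < toℕ i → p ∣ g′ i j
    by-column j (acc smaller) j<i = subst (p ∣_) entry (∣m⇒∣-m (∣-Σ _ term))
      where
      entry : - (g′ ⊗ (g ⊖ I)) i j ≡ g′ i j
      entry = trans (sym (⊖I-inverse {g = g} {g′ = g′} g′g≈I i j)) (⊖I-offDiagonal g′ (<⇒≢ j<i ∘ sym))
      term : ∀ l → p ∣ g′ i l * (g ⊖ I) l j
      term l with toℕ l ℕ.<? toℕ j
      ... | yes l<j = ∣m⇒∣m*n ((g ⊖ I) l j) (by-column l (smaller l<j) (ℕ.<-trans l<j j<i))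
      ... | no  l≮j = ∣n⇒∣m*n (g′ i l) (g-unitri l j (ℕ.≮⇒≥ l≮j))

module _ {M : ℕ} {p q : ℤ} where

  Λ-entry : {X : Mat M} → Λ p q X → ∀ i j → q ∣ X i j
  Λ-entry ΛX i j with toℕ i ℕ.<? toℕ j
  ... | yes i<j = ΛX .above i j i<j
  ... | no  i≮j = ∣-trans (divides p refl) (ΛX .onOrBelow i j (ℕ.≮⇒≥ i≮j))

  Λ-resp : {X Y : Mat M} → X ≈ Y → Λ p q X → Λ p q Y
  Λ-resp X≈Y ΛX .above     i j i<j = subst (q ∣_) (X≈Y i j) (ΛX .above i j i<j)
  Λ-resp X≈Y ΛX .onOrBelow i j j≤i = subst (p * q ∣_) (X≈Y i j) (ΛX .onOrBelow i j j≤i)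

  Λ-⊕ : {X Y : Mat M} → Λ p q X → Λ p q Y → Λ p q (X ⊕ Y)
  Λ-⊕ ΛX ΛY .above     i j i<j = ∣m∣n⇒∣m+n (ΛX .above i j i<j) (ΛY .above i j i<j)
  Λ-⊕ ΛX ΛY .onOrBelow i j j≤i = ∣m∣n⇒∣m+n (ΛX .onOrBelow i j j≤i) (ΛY .onOrBelow i j j≤i)

  Λ-⊝ : {X : Mat M} → Λ p q X → Λ p q (⊝ X)
  Λ-⊝ ΛX .above     i j i<j = ∣m⇒∣-m (ΛX .above i j i<j)
  Λ-⊝ ΛX .onOrBelow i j j≤i = ∣m⇒∣-m (ΛX .onOrBelow i j j≤i)

  Λ-zero : Λ p q (I {M} ⊖ I)
  Λ-zero .above     i j _ = subst (q ∣_) (sym (ℤ.+-inverseʳ (δ i j))) (divides (+ 0) refl)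
  Λ-zero .onOrBelow i j _ = subst (p * q ∣_) (sym (ℤ.+-inverseʳ (δ i j))) (divides (+ 0) refl)

  triangular-⊗-Λ : {U X : Mat M} → UpperTriangularMod p U → Λ p q X → Λ p q (U ⊗ X)
  triangular-⊗-Λ {U} {X} U-tri ΛX .above i j _ = ∣-Σ _ (λ l → ∣n⇒∣m*n (U i l) (Λ-entry ΛX l j))
  triangular-⊗-Λ {U} {X} U-tri ΛX .onOrBelow i j j≤i = ∣-Σ _ term
    where
    term : ∀ l → p * q ∣ U i l * X l j
    term l with toℕ l ℕ.<? toℕ j
    ... | yes l<j = *-mono-∣ (U-tri i l (ℕ.<-≤-trans l<j j≤i)) (Λ-entry ΛX l j)
    ... | no  l≮j = ∣n⇒∣m*n (U i l) (ΛX .onOrBelow l j (ℕ.≮⇒≥ l≮j))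

  Λ-⊗-triangular : {X U : Mat M} → Λ p q X → UpperTriangularMod p U → Λ p q (X ⊗ U)
  Λ-⊗-triangular {X} {U} ΛX U-tri .above i j _ = ∣-Σ _ (λ l → ∣m⇒∣m*n (U l j) (Λ-entry ΛX i l))
  Λ-⊗-triangular {X} {U} ΛX U-tri .onOrBelow i j j≤i = ∣-Σ _ term
    where
    term : ∀ l → p * q ∣ X i l * U l j
    term l with toℕ i ℕ.<? toℕ l
    ... | yes i<l = subst (_∣ X i l * U l j) (ℤ.*-comm q p)
                          (*-mono-∣ (ΛX .above i l i<l) (U-tri l j (ℕ.≤-<-trans j≤i i<l)))
    ... | no  i≮l = ∣m⇒∣m*n (U l j) (ΛX .onOrBelow i l (ℕ.≮⇒≥ i≮l))

  Λ⇒unitriangular : {g : Mat M} → Λ p q (g ⊖ I) → UnitriangularMod p g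
  Λ⇒unitriangular Λg i j j≤i = ∣-trans (divides q (ℤ.*-comm p q)) (Λg .onOrBelow i j j≤i)

  Λ-⊗ : {g h : Mat M} → Λ p q (g ⊖ I) → Λ p q (h ⊖ I) → Λ p q ((g ⊗ h) ⊖ I)
  Λ-⊗ {g} {h} Λg Λh = Λ-resp (≈-sym (⊖I-⊗ g h))
    (Λ-⊕ (triangular-⊗-Λ (unitriangular⇒triangular {p = p} {g = g} (Λ⇒unitriangular {g = g} Λg)) Λh) Λg)

  Λ-inverse : {g g′ : Mat M} → Λ p q (g ⊖ I) → (g′ ⊗ g) ≈ I → Λ p q (g′ ⊖ I)
  Λ-inverse {g} {g′} Λg g′g≈I = Λ-resp (≈-sym (⊖I-inverse {g = g} {g′ = g′} g′g≈I))
    (Λ-⊝ (triangular-⊗-Λ (inverse-triangular {p = p} {g = g} {g′ = g′} (Λ⇒unitriangular {g = g} Λg) g′g≈I)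
                         Λg))

  Λ-conjugate : {g g′ h : Mat M} → UnitriangularMod p g → (g ⊗ g′) ≈ I → (g′ ⊗ g) ≈ I →
                Λ p q (h ⊖ I) → Λ p q ((g ⊗ h ⊗ g′) ⊖ I)
  Λ-conjugate {g} {g′} {h} g-unitri gg′≈I g′g≈I Λh = Λ-resp (≈-sym (⊖I-conjugate {g = g} {g′} h gg′≈I))
    (Λ-⊗-triangular (triangular-⊗-Λ (unitriangular⇒triangular {p = p} {g = g} g-unitri) Λh)
                    (inverse-triangular {p = p} {g = g} {g′ = g′} g-unitri g′g≈I))

Λ-weaken : ∀ {M} {p q q′ : ℤ} {X : Mat M} → q′ ∣ q → Λ p q X → Λ p q′ X
Λ-weaken q′∣q ΛX .above     i j i<j = ∣-trans q′∣q (ΛX .above i j i<j)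
Λ-weaken {p = p} q′∣q ΛX .onOrBelow i j j≤i = ∣-trans (*-monoʳ-∣ p q′∣q) (ΛX .onOrBelow i j j≤i)

prime⇒1<p : ∀ {p} → Prime p → 1 < p
prime⇒1<p {p} p-prime = ℕ.nonTrivial⇒n>1 p {{prime⇒nonTrivial p-prime}}

n<m^n : ∀ {m} → 1 < m → ∀ n → n < m ^ n
n<m^n     1<m zero    = s≤s z≤n
n<m^n {m} 1<m (suc n) = ℕ.≤-<-trans (n<m^n 1<m n) (ℕ.^-monoʳ-< m 1<m (ℕ.n<1+n n))

^-monoʳ-∣ : ∀ p {f e} → f ≤ e → p ^ f ℕD.∣ p ^ e
^-monoʳ-∣ p {f} {e} f≤e = subst (p ^ f ℕD.∣_) p^f*p^[e∸f]≡p^e (ℕD.m∣m*n (p ^ (e ∸ f)))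
  where
  p^f*p^[e∸f]≡p^e : p ^ f ℕ.* p ^ (e ∸ f) ≡ p ^ e
  p^f*p^[e∸f]≡p^e = trans (sym (ℕ.^-distribˡ-+-* p f (e ∸ f))) (cong (p ^_) (ℕ.m+[n∸m]≡n f≤e))

ExactPower : ℕ → ℕ → ℕ → Set
ExactPower p e n = p ^ e ℕD.∣ n × ¬ p ^ suc e ℕD.∣ n

-- Search upwards from f; the exponent cannot exceed n because f < p ^ f ≤ n.
exact-exponent : ∀ {p n} → Prime p → 0 < n → ∀ f → p ^ f ℕD.∣ n → Σ[ e ∈ ℕ ] f ≤ e × ExactPower p e n
exact-exponent {p} {n} p-prime 0<n f p^f∣n =
  search (n ∸ f) f (ℕ.m+[n∸m]≡n (ℕ.<⇒≤ (below {f} p^f∣n))) p^f∣n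
  where
  below : ∀ {f} → p ^ f ℕD.∣ n → f < n
  below {f} p^f∣n = ℕ.<-≤-trans (n<m^n (prime⇒1<p p-prime) f) (ℕD.∣⇒≤ {{ℕ.>-nonZero 0<n}} p^f∣n)
  search : ∀ fuel f → f ℕ.+ fuel ≡ n → p ^ f ℕD.∣ n → Σ[ e ∈ ℕ ] f ≤ e × ExactPower p e n
  search fuel f _ p^f∣n with p ^ suc f ℕD.∣? n
  ... | no p^f+1∤n = f , ℕ.≤-refl , p^f∣n , p^f+1∤n
  search zero f f+0≡n _ | yes p^f+1∣n =
    ⊥-elim (ℕ.<-irrefl (trans (sym (ℕ.+-identityʳ f)) f+0≡n) (below (ℕD.∣-trans (ℕD.n∣m*n p) p^f+1∣n)))
  search (suc fuel) f f+fuel+1≡n _ | yes p^f+1∣n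
    with e , f+1≤e , p^e∣n , p^e+1∤n ← search fuel (suc f) (trans (sym (ℕ.+-suc f fuel)) f+fuel+1≡n) p^f+1∣n
    = e , ℕ.≤-trans (ℕ.n≤1+n f) f+1≤e , p^e∣n , p^e+1∤n

prime∣^⇒∣ : ∀ {p q} → Prime q → ∀ k → q ℕD.∣ p ^ k → q ℕD.∣ p
prime∣^⇒∣     q-prime zero    q∣1   = ⊥-elim (ℕ.<⇒≢ (prime⇒1<p q-prime) (sym (ℕD.∣1⇒≡1 q∣1)))
prime∣^⇒∣ {p} q-prime (suc k) q∣p^k+1 with euclidsLemma p (p ^ k) q-prime q∣p^k+1
... | inj₁ q∣p   = q∣p
... | inj₂ q∣p^k = prime∣^⇒∣ q-prime k q∣p^k

prime∣ₛprime^ : ∀ {p k} → 1 ≤ k → p ∣ₛ (p ^ k)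
prime∣ₛprime^ {p} {suc k} _ = ℕD.m∣m*n (p ^ k) , λ q q-prime → prime∣^⇒∣ q-prime (suc k)

-- The groups Γ₁

module _ {M : ℕ} where

  SL-conjugate : {g g′ h : Mat M} → SL g → (g ⊗ g′) ≈ I → SL h → SL (g ⊗ h ⊗ g′)
  SL-conjugate {g} {g′} {h} g∈SL gg′≈I h∈SL =
    SL-⊗ {g = g ⊗ h} {g′} (SL-⊗ {g = g} {h} g∈SL h∈SL) (SL-inverse {g = g} {g′} g∈SL gg′≈I)

module _ {M : ℕ} {p e : ℕ} where

  Γ₁pp⇒Λ : {g : Mat M} → Γ₁pp p (suc e) g → Λ (+ p) (+ (p ^ e)) (g ⊖ I)
  Γ₁pp⇒Λ {g} (_ , upper , _) .above i j i<j =
    subst (_ ∣_) (sym (⊖I-offDiagonal g (<⇒≢ i<j))) (∣ᵤ⇒∣ (upper i j i<j))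
  Γ₁pp⇒Λ {g} (_ , _ , lower) .onOrBelow i j j≤i =
    subst (_∣ (g ⊖ I) i j) (ℤ.pos-* p (p ^ e)) (∣ᵤ⇒∣ (lower i j j≤i))

  Λ⇒Γ₁pp : {g : Mat M} → SL g → Λ (+ p) (+ (p ^ e)) (g ⊖ I) → Γ₁pp p (suc e) g
  Λ⇒Γ₁pp {g} g∈SL Λg = g∈SL
    , (λ i j i<j → ∣⇒∣ᵤ (subst (_ ∣_) (⊖I-offDiagonal g (<⇒≢ i<j)) (Λg .above i j i<j)))
    , (λ i j j≤i → ∣⇒∣ᵤ (subst (_∣ (g ⊖ I) i j) (sym (ℤ.pos-* p (p ^ e))) (Λg .onOrBelow i j j≤i)))

  Γ₁pp-I : Γ₁pp p (suc e) (I {M})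
  Γ₁pp-I = Λ⇒Γ₁pp (det-I {M}) Λ-zero

  Γ₁pp-⊗ : {g h : Mat M} → Γ₁pp p (suc e) g → Γ₁pp p (suc e) h → Γ₁pp p (suc e) (g ⊗ h)
  Γ₁pp-⊗ {g} {h} g∈Γ h∈Γ =
    Λ⇒Γ₁pp (SL-⊗ {g = g} {h} (proj₁ g∈Γ) (proj₁ h∈Γ)) (Λ-⊗ {g = g} {h} (Γ₁pp⇒Λ g∈Γ) (Γ₁pp⇒Λ h∈Γ))

  Γ₁pp-inverse : {g g′ : Mat M} → Γ₁pp p (suc e) g → (g ⊗ g′) ≈ I → (g′ ⊗ g) ≈ I → Γ₁pp p (suc e) g′
  Γ₁pp-inverse {g} {g′} g∈Γ gg′≈I g′g≈I =
    Λ⇒Γ₁pp (SL-inverse {g = g} {g′} (proj₁ g∈Γ) gg′≈I) (Λ-inverse {g = g} {g′} (Γ₁pp⇒Λ g∈Γ) g′g≈I)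

  Γ₁pp-conjugate : {g g′ h : Mat M} → SL g → UnitriangularMod (+ p) g → (g ⊗ g′) ≈ I → (g′ ⊗ g) ≈ I →
                   Γ₁pp p (suc e) h → Γ₁pp p (suc e) (g ⊗ h ⊗ g′)
  Γ₁pp-conjugate {g} {g′} {h} g∈SL g-unitri gg′≈I g′g≈I h∈Γ =
    Λ⇒Γ₁pp (SL-conjugate {g = g} {g′} {h} g∈SL gg′≈I (proj₁ h∈Γ))
           (Λ-conjugate {g = g} {g′} {h} g-unitri gg′≈I g′g≈I (Γ₁pp⇒Λ h∈Γ))

  Γ₁pp⇒unitriangular : {g : Mat M} → Γ₁pp p (suc e) g → UnitriangularMod (+ p) g
  Γ₁pp⇒unitriangular {g} g∈Γ = Λ⇒unitriangular {g = g} (Γ₁pp⇒Λ g∈Γ)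

Γ₁pp-weaken : ∀ {M p f e} {g : Mat M} → f ≤ e → Γ₁pp p (suc e) g → Γ₁pp p (suc f) g
Γ₁pp-weaken {p = p} {f} {e} {g} f≤e g∈Γ = Λ⇒Γ₁pp {p = p} {e = f} (proj₁ g∈Γ)
  (Λ-weaken {X = g ⊖ I} (∣ᵤ⇒∣ (^-monoʳ-∣ p f≤e)) (Γ₁pp⇒Λ {p = p} {e = e} g∈Γ))

module _ {M n : ℕ} where

  Γ₁-I : Γ₁ n (I {M})
  Γ₁-I = det-I {M} , λ { p (suc e) _ _ _ _ → Γ₁pp-I {p = p} {e = e} }

  Γ₁-⊗ : {g h : Mat M} → Γ₁ n g → Γ₁ n h → Γ₁ n (g ⊗ h)
  Γ₁-⊗ {g} {h} (g∈SL , g∈Γ) (h∈SL , h∈Γ) = SL-⊗ {g = g} {h} g∈SL h∈SL , λ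
    { p (suc e) p-prime 1≤e p^e∣n p^e+1∤n → Γ₁pp-⊗ {p = p} {e = e} {g = g} {h}
        (g∈Γ p (suc e) p-prime 1≤e p^e∣n p^e+1∤n) (h∈Γ p (suc e) p-prime 1≤e p^e∣n p^e+1∤n) }

  Γ₁-inverse : {g g′ : Mat M} → Γ₁ n g → (g ⊗ g′) ≈ I → (g′ ⊗ g) ≈ I → Γ₁ n g′
  Γ₁-inverse {g} {g′} (g∈SL , g∈Γ) gg′≈I g′g≈I = SL-inverse {g = g} {g′} g∈SL gg′≈I , λ
    { p (suc e) p-prime 1≤e p^e∣n p^e+1∤n → Γ₁pp-inverse {p = p} {e = e} {g = g} {g′}
        (g∈Γ p (suc e) p-prime 1≤e p^e∣n p^e+1∤n) gg′≈I g′g≈I }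

  Γ₁-conjugate : {g g′ h : Mat M} → SL g → (∀ p → Prime p → p ℕD.∣ n → UnitriangularMod (+ p) g) →
                 (g ⊗ g′) ≈ I → (g′ ⊗ g) ≈ I → Γ₁ n h → Γ₁ n (g ⊗ h ⊗ g′)
  Γ₁-conjugate {g} {g′} {h} g∈SL g-unitri gg′≈I g′g≈I (h∈SL , h∈Γ) =
    SL-conjugate {g = g} {g′} {h} g∈SL gg′≈I h∈SL , λ
    { p (suc e) p-prime 1≤e p^e∣n p^e+1∤n → Γ₁pp-conjugate {p = p} {e = e} {g = g} {g′} {h}
        g∈SL (g-unitri p p-prime (ℕD.∣-trans (ℕD.m∣m*n (p ^ e)) p^e∣n)) gg′≈I g′g≈I
        (h∈Γ p (suc e) p-prime 1≤e p^e∣n p^e+1∤n) }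

  Γ₁-unitriangular : ∀ {p} {g : Mat M} → 0 < n → Prime p → p ℕD.∣ n → Γ₁ n g → UnitriangularMod (+ p) g
  Γ₁-unitriangular {p} {g} 0<n p-prime p∣n (_ , g∈Γ)
    with suc e , _ , p^e∣n , p^e+1∤n ← exact-exponent p-prime 0<n 1 (subst (ℕD._∣ n) (sym (ℕ.*-identityʳ p)) p∣n)
    = Γ₁pp⇒unitriangular {p = p} {e = e} {g = g} (g∈Γ p (suc e) p-prime (s≤s z≤n) p^e∣n p^e+1∤n)

  Γ₁-mono : ∀ {m} {g : Mat M} → 0 < n → m ℕD.∣ n → Γ₁ n g → Γ₁ m g
  Γ₁-mono {g = g} 0<n m∣n (g∈SL , g∈Γ) = g∈SL , λ
    { p (suc f) p-prime _ p^f∣m _ → weaken p-prime (exact-exponent p-prime 0<n (suc f) (ℕD.∣-trans p^f∣m m∣n)) }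
    where
    weaken : ∀ {p f} → Prime p → Σ[ e ∈ ℕ ] suc f ≤ e × ExactPower p e n → Γ₁pp p (suc f) g
    weaken {p} p-prime (suc e , s≤s f≤e , p^e∣n , p^e+1∤n) =
      Γ₁pp-weaken {p = p} {g = g} f≤e (g∈Γ p (suc e) p-prime (s≤s z≤n) p^e∣n p^e+1∤n)

Γ₁-normal : ∀ {M m n} → 0 < n → m ∣ₛ n → IsNormalSubgroupOf {M} (Γ₁ n) (Γ₁ m)
Γ₁-normal {M} {m} {n} 0<n (m∣n , primes-of-n∣m) =
    (λ _ → Γ₁-mono 0<n m∣n)
  , Γ₁-I
  , (λ _ _ → Γ₁-⊗)
  , (λ _ _ → Γ₁-inverse)
  , (λ g _ _ g∈Γₘ → Γ₁-conjugate (proj₁ g∈Γₘ) (λ p p-prime p∣n →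
       Γ₁-unitriangular {g = g} 0<m p-prime (primes-of-n∣m p p-prime p∣n) g∈Γₘ))
  where
  0<m : 0 < m
  0<m = ℕ.n≢0⇒n>0 (λ { refl → ℕ.<⇒≢ 0<n (sym (ℕD.0∣⇒≡0 m∣n)) })

-- The argument works in every dimension M.
proposition3p1 : (M : ℕ) → 2 ≤ M →
    ((p k : ℕ) → Prime p → 1 ≤ k →
       IsNormalSubgroupOf {M} (Γ₁ (p ^ k)) (Γ₁ p))
    × ((m n : ℕ) → 0 < n → m ∣ₛ n → IsNormalSubgroupOf {M} (Γ₁ n) (Γ₁ m))
proposition3p1 M _ =
    (λ p k p-prime 1≤k → Γ₁-normal (ℕ.m^n>0 p {{prime⇒nonZero p-prime}} k) (prime∣ₛprime^ 1≤k))
  , (λ m n → Γ₁-normal)
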